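{- Let $q$ and $w$ be indeterminates, let $z=w^2$, and write $z^{1/2}=w$ and $q^{m/2}$ for the appropriate powers of $q^{1/2}$ (work in the field of rational functions in $w$ and $q^{1/2}$). For a positive integer $n$, let $M=M(n)$ be the $n\times n$ tridiagonal matrix with entries \[ M_{i,j}=\begin{cases} 1 & \text{if } i=j,\\ z^{1/2}q^{(i-1)/2}& \text{if } i=j-1,\\ z^{1/2}q^{(i-2)/2}& \text{if } i=j+1,\\ 0&\text{otherwise,} \end{cases}\qquad 1\le i,j\le n. \] For $j\ge 0$ let \[ \lambda(j)=\sum_{0\le k\le j/2}\begin{bmatrix} j-k\\ k\end{bmatrix}_q(-1)^kq^{k(k-1)}z^k . \] Let $U$ be the $n\times n$ matrix with $U_{j,j}=\lambda(j)/\lambda(j-1)$ for $1\le j\le n$, $U_{j,j+1}=z^{1/2}q^{(j-1)/2}$ for $1\le j\le n-1$, and all other entries $0$; and let $L$ be the $n\times n$ matrix with $L_{j,j}=1$ for $1\le j\le n$, $L_{j+1,j}=z^{1/2}q^{(j-1)/2}\lambda(j-1)/\lambda(j)$ for $1\le j\le n-1$, and all other entries $0$. Then $LU=M$.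
   Context: The Gaussian $q$-binomial coefficient is $\begin{bmatrix} n\\ k\end{bmatrix}_q=\frac{(q;q)_n}{(q;q)_k(q;q)_{n-k}}$ with $(x;q)_n=(1-x)(1-xq)\cdots(1-xq^{n-1})$. -}

module Defs where

open import Data.Nat.Base using (ℕ; zero; suc; _∸_; _≡ᵇ_; ⌊_/2⌋) renaming (_+_ to _+ℕ_; _*_ to _*ℕ_)
open import Data.Integer.Base using (ℤ; +_; -_) renaming (_+_ to _+ℤ_; _*_ to _*ℤ_)
open import Data.Bool.Base using (if_then_else_; _∧_)
open import Data.List.Base using (List; []; _∷_; _++_; map; concatMap)
open import Data.Product.Base using (_×_; _,_)
open import Data.Fin.Base using (Fin; toℕ) renaming (zero to fzero; suc to fsuc)
open import Relation.Binary.PropositionalEquality using (_≡_)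
open import Relation.Nullary using (¬_)

-- Polynomials in two indeterminates over ℤ:
--   w  (with z = w²)   and   s = q^{1/2}   (so q = s²).
-- A polynomial is a formal finite sum of monomials c · w^a · s^b,
-- represented as a list of (c , a , b); two polynomials are equal
-- when all their coefficients agree.

Mono : Set
Mono = ℤ × ℕ × ℕ

Poly : Set
Poly = List Mono

coeff : Poly → ℕ → ℕ → ℤ
coeff [] x y = + 0
coeff ((c , a , b) ∷ p) x y =
  (if (a ≡ᵇ x) ∧ (b ≡ᵇ y) then c else + 0) +ℤ coeff p x y

_≈P_ : Poly → Poly → Set
p ≈P r = ∀ x y → coeff p x y ≡ coeff r x y

0P : Poly
0P = []

1P : Poly
1P = (+ 1 , 0 , 0) ∷ []

_+P_ : Poly → Poly → Poly
p +P r = p ++ r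

-P_ : Poly → Poly
-P p = map (λ { (c , a , b) → (- c , a , b) }) p

mulMono : Mono → Mono → Mono
mulMono (c , a , b) (d , a' , b') = (c *ℤ d , a +ℕ a' , b +ℕ b')

_*P_ : Poly → Poly → Poly
p *P r = concatMap (λ m → map (mulMono m) r) p

record Frac : Set where
  constructor _/_
  field
    num : Poly
    den : Poly
open Frac public

_≈F_ : Frac → Frac → Set
(a / b) ≈F (c / d) = (a *P d) ≈P (c *P b)

0F 1F : Frac
0F = 0P / 1P
1F = 1P / 1P

poly : Poly → Frac
poly p = p / 1P

_+F_ : Frac → Frac → Frac
(a / b) +F (c / d) = ((a *P d) +P (c *P b)) / (b *P d)

_*F_ : Frac → Frac → Frac
(a / b) *F (c / d) = (a *P c) / (b *P d)

_÷F_ : Frac → Frac → Frac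
(a / b) ÷F (c / d) = (a *P d) / (b *P c)

wF : Frac
wF = poly ((+ 1 , 1 , 0) ∷ [])

qhalf^ : ℕ → Frac
qhalf^ m = poly ((+ 1 , 0 , m) ∷ [])

-- q-Pochhammer (q;q)_m = ∏_{i=1}^{m} (1 - q^i), with q^i = s^{2i}.

qPoch : ℕ → Poly
qPoch zero = 1P
qPoch (suc m) = qPoch m *P ((+ 1 , 0 , 0) ∷ (- (+ 1) , 0 , 2 *ℕ suc m) ∷ [])

-- Gaussian q-binomial [m k]_q = (q;q)_m / ((q;q)_k (q;q)_{m-k})
-- (only used with k ≤ m).
qbinom : ℕ → ℕ → Frac
qbinom m k = qPoch m / (qPoch k *P qPoch (m ∸ k))

negOnePow : ℕ → ℤ
negOnePow zero = + 1
negOnePow (suc k) = - negOnePow k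

sumTo : ℕ → (ℕ → Frac) → Frac
sumTo zero f = 0F
sumTo (suc n) f = sumTo n f +F f n

-- λ(j) = Σ_{0 ≤ k ≤ j/2} [j-k k]_q (-1)^k q^{k(k-1)} z^k ,
-- with q^{k(k-1)} = s^{2k(k-1)} and z^k = w^{2k}.
lam : ℕ → Frac
lam j = sumTo (suc ⌊ j /2⌋) (λ k →
  qbinom (j ∸ k) k *F
  poly ((negOnePow k , 2 *ℕ k , 2 *ℕ (k *ℕ (k ∸ 1))) ∷ []))

-- Matrices, indexed from 0 (paper index i corresponds to i - 1 here).

Mat : ℕ → Set
Mat n = Fin n → Fin n → Frac

sumFin : ∀ n → (Fin n → Frac) → Frac
sumFin zero f = 0F
sumFin (suc n) f = f fzero +F sumFin n (λ k → f (fsuc k))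

_⊗_ : ∀ {n} → Mat n → Mat n → Mat n
(A ⊗ B) i j = sumFin _ (λ k → A i k *F B k j)

_≈M_ : ∀ {n} → Mat n → Mat n → Set
A ≈M B = ∀ i j → A i j ≈F B i j

-- 0-indexed entries: paper (i+1, j+1).
-- M: diagonal 1; M_{i,i+1} = w s^{i}; M_{j+1,j} = w s^{j}.
Mℕ : ℕ → ℕ → Frac
Mℕ i j =
  if i ≡ᵇ j then 1F
  else if suc i ≡ᵇ j then wF *F qhalf^ i
  else if i ≡ᵇ suc j then wF *F qhalf^ j
  else 0F

Uℕ : ℕ → ℕ → Frac
Uℕ i j =
  if i ≡ᵇ j then lam (suc i) ÷F lam i
  else if suc i ≡ᵇ j then wF *F qhalf^ i
  else 0F

Lℕ : ℕ → ℕ → Frac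
Lℕ i j =
  if i ≡ᵇ j then 1F
  else if i ≡ᵇ suc j then (wF *F qhalf^ j) *F (lam j ÷F lam (suc j))
  else 0F

M U L : ∀ n → Mat n
M n i j = Mℕ (toℕ i) (toℕ j)
U n i j = Uℕ (toℕ i) (toℕ j)
L n i j = Lℕ (toℕ i) (toℕ j)

module Submission where

-- Since ≈F is only
-- transitive for nonzero denominators, fractions are then simplified with the
-- preorder F ≽ G ("F is G with numerator and denominator multiplied by one
-- common polynomial"), a congruence for all field operations; a single ≈F
-- check at the end of each computation suffices.
-- Part (1): the value of λ(j) at w = s = 0 is 1, so λ(j) ≠ 0.
-- Part (2): via the q-Pascal rule [n k]_q is a polynomial, and λ(j) ≽ Λ j
-- for the leading principal minors (continuants) of M,
--     Λ 0 = Λ 1 = 1 ,   Λ (t+2) = Λ (t+1) − (w s^t)² Λ t .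
-- Row i of L is supported on columns i−1 and i, so each entry of LU is a sum
-- of at most two products; off the diagonal λ cancels and the entries of M
-- remain, and on the diagonal (LU)_{t+1,t+1} = 1 is exactly the recurrence.

open import Defs
open import Data.Nat.Base using (ℕ; zero; suc; _∸_; _≡ᵇ_; _≤ᵇ_; _<_; _≤_; z≤n; s≤s; ⌊_/2⌋)
  renaming (_+_ to _+ℕ_; _*_ to _*ℕ_)
import Data.Nat.Properties as ℕP
open import Data.Nat.Tactic.RingSolver using () renaming (solve-∀ to ℕ-solve)
open import Data.Integer.Base using (ℤ; +_; -_) renaming (_+_ to _+ℤ_; _*_ to _*ℤ_)
import Data.Integer.Properties as ℤP
open import Data.Bool.Base using (Bool; true; false; if_then_else_; _∧_; T)
open import Data.List.Base using (List; []; _∷_; _++_; map; concatMap)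
import Data.List.Properties as ListP
open import Data.Maybe.Base using (Maybe; just; nothing)
import Data.Maybe.Base as Maybe
open import Data.Product.Base using (_×_; _,_; proj₁; proj₂)
open import Data.Unit.Base using (⊤; tt)
open import Data.Empty using (⊥-elim)
open import Data.Fin.Base using (toℕ)
import Data.Fin.Properties as FinP
open import Relation.Nullary using (¬_; yes; no)
open import Relation.Nullary.Decidable using (dec-true; dec-false)
open import Relation.Binary.PropositionalEquality
  using (_≡_; _≢_; refl; sym; trans; cong; cong₂; subst; subst₂; isEquivalence; module ≡-Reasoning)
open import Level using (0ℓ)
import Relation.Binary.Reasoning.Setoid
open import Relation.Binary.Structures using (IsEquivalence)
open import Relation.Binary.Bundles using (Preorder)
import Relation.Binary.Reasoning.Preorder
open import Algebra.Bundles using (CommutativeRing)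
open import Tactic.RingSolver.Core.AlmostCommutativeRing using (AlmostCommutativeRing; fromCommutativeRing)
open import Tactic.RingSolver using (solve-∀)
open import Algebra.Properties.CommutativeSemigroup ℤP.+-commutativeSemigroup
  using () renaming (interchange to +ℤ-interchange)

sumℤ : {A : Set} → (A → ℤ) → List A → ℤ
sumℤ f [] = + 0
sumℤ f (u ∷ us) = f u +ℤ sumℤ f us

monoCoeff : Mono → ℕ → ℕ → ℤ
monoCoeff (c , a , b) x y = if (a ≡ᵇ x) ∧ (b ≡ᵇ y) then c else + 0

coeff≡sumℤ : ∀ p x y → coeff p x y ≡ sumℤ (λ u → monoCoeff u x y) p
coeff≡sumℤ [] x y = refl
coeff≡sumℤ (m ∷ p) x y = cong (monoCoeff m x y +ℤ_) (coeff≡sumℤ p x y)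

sumℤ-cong : {A : Set} {f g : A → ℤ} → (∀ u → f u ≡ g u) → ∀ us → sumℤ f us ≡ sumℤ g us
sumℤ-cong eq [] = refl
sumℤ-cong eq (u ∷ us) = cong₂ _+ℤ_ (eq u) (sumℤ-cong eq us)

sumℤ-zero : {A : Set} (us : List A) → sumℤ (λ _ → + 0) us ≡ + 0
sumℤ-zero [] = refl
sumℤ-zero (_ ∷ us) = trans (ℤP.+-identityˡ _) (sumℤ-zero us)

sumℤ-++ : {A : Set} (f : A → ℤ) (us vs : List A) → sumℤ f (us ++ vs) ≡ sumℤ f us +ℤ sumℤ f vs
sumℤ-++ f [] vs = sym (ℤP.+-identityˡ _)
sumℤ-++ f (u ∷ us) vs = trans (cong (f u +ℤ_) (sumℤ-++ f us vs)) (sym (ℤP.+-assoc (f u) _ _))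

sumℤ-map : {A B : Set} (f : B → ℤ) (g : A → B) (us : List A) → sumℤ f (map g us) ≡ sumℤ (λ u → f (g u)) us
sumℤ-map f g [] = refl
sumℤ-map f g (u ∷ us) = cong (f (g u) +ℤ_) (sumℤ-map f g us)

sumℤ-concatMap : {A B : Set} (f : B → ℤ) (g : A → List B) (us : List A) →
  sumℤ f (concatMap g us) ≡ sumℤ (λ u → sumℤ f (g u)) us
sumℤ-concatMap f g [] = refl
sumℤ-concatMap f g (u ∷ us) =
  trans (sumℤ-++ f (g u) (concatMap g us)) (cong (sumℤ f (g u) +ℤ_) (sumℤ-concatMap f g us))

sumℤ-+ : {A : Set} (f g : A → ℤ) (us : List A) → sumℤ (λ u → f u +ℤ g u) us ≡ sumℤ f us +ℤ sumℤ g us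
sumℤ-+ f g [] = refl
sumℤ-+ f g (u ∷ us) =
  trans (cong ((f u +ℤ g u) +ℤ_) (sumℤ-+ f g us)) (+ℤ-interchange (f u) (g u) (sumℤ f us) (sumℤ g us))

sumℤ-*ˡ : {A : Set} (c : ℤ) (f : A → ℤ) (us : List A) → sumℤ (λ u → c *ℤ f u) us ≡ c *ℤ sumℤ f us
sumℤ-*ˡ c f [] = sym (ℤP.*-zeroʳ c)
sumℤ-*ˡ c f (u ∷ us) = trans (cong (c *ℤ f u +ℤ_) (sumℤ-*ˡ c f us)) (sym (ℤP.*-distribˡ-+ c (f u) (sumℤ f us)))

sumℤ-swap : {A B : Set} (f : A → B → ℤ) (us : List A) (vs : List B) →
  sumℤ (λ u → sumℤ (f u) vs) us ≡ sumℤ (λ v → sumℤ (λ u → f u v) us) vs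
sumℤ-swap f [] vs = sym (sumℤ-zero vs)
sumℤ-swap f (u ∷ us) vs =
  trans (cong (sumℤ (f u) vs +ℤ_) (sumℤ-swap f us vs)) (sym (sumℤ-+ (f u) (λ v → sumℤ (λ u' → f u' v) us) vs))

coeff-++ : ∀ p r x y → coeff (p +P r) x y ≡ coeff p x y +ℤ coeff r x y
coeff-++ p r x y = trans (coeff≡sumℤ (p ++ r) x y)
  (trans (sumℤ-++ _ p r) (sym (cong₂ _+ℤ_ (coeff≡sumℤ p x y) (coeff≡sumℤ r x y))))

coeff-neg : ∀ p x y → coeff (-P p) x y ≡ - coeff p x y
coeff-neg [] x y = refl
coeff-neg ((c , a , b) ∷ p) x y =
  trans (cong₂ _+ℤ_ (negIf ((a ≡ᵇ x) ∧ (b ≡ᵇ y))) (coeff-neg p x y))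
        (sym (ℤP.neg-distrib-+ (monoCoeff (c , a , b) x y) (coeff p x y)))
  where
  negIf : ∀ t → (if t then - c else + 0) ≡ - (if t then c else + 0)
  negIf true = refl
  negIf false = refl

coeff-*P : ∀ p r x y → coeff (p *P r) x y ≡ sumℤ (λ m → sumℤ (λ n → monoCoeff (mulMono m n) x y) r) p
coeff-*P p r x y = trans (coeff≡sumℤ (p *P r) x y)
  (trans (sumℤ-concatMap (λ u → monoCoeff u x y) (λ m → map (mulMono m) r) p)
         (sumℤ-cong (λ m → sumℤ-map (λ u → monoCoeff u x y) (mulMono m) r) p))

+≡ᵇ-split : ∀ a a' x → (a +ℕ a' ≡ᵇ x) ≡ (a ≤ᵇ x) ∧ (a' ≡ᵇ x ∸ a)
+≡ᵇ-split zero a' x = refl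
+≡ᵇ-split (suc a) a' zero = refl
+≡ᵇ-split (suc a) a' (suc x) = trans (+≡ᵇ-split a a' x) (cong (_∧ (a' ≡ᵇ x ∸ a)) (≤ᵇ-suc a x))
  where
  ≤ᵇ-suc : ∀ a x → (a ≤ᵇ x) ≡ (suc a ≤ᵇ suc x)
  ≤ᵇ-suc zero x = refl
  ≤ᵇ-suc (suc a) zero = refl
  ≤ᵇ-suc (suc a) (suc x) = refl

-- the coefficient of w^x s^y in (c w^a s^b)·r is c times a shifted coefficient
-- of r; hence it depends on r only through its coefficients
shiftedCoeff : Mono → Poly → ℕ → ℕ → ℤ
shiftedCoeff (c , a , b) r x y = if (a ≤ᵇ x) ∧ (b ≤ᵇ y) then c *ℤ coeff r (x ∸ a) (y ∸ b) else + 0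

coeff-mono* : ∀ m r x y → sumℤ (λ n → monoCoeff (mulMono m n) x y) r ≡ shiftedCoeff m r x y
coeff-mono* (c , a , b) r x y = trans (sumℤ-cong termwise r) (summed ((a ≤ᵇ x) ∧ (b ≤ᵇ y)))
  where
  shifted : Mono → ℤ
  shifted n = monoCoeff n (x ∸ a) (y ∸ b)
  regroup : ∀ (A A' B B' : Bool) (d : ℤ) →
    (if (A ∧ A') ∧ (B ∧ B') then c *ℤ d else + 0) ≡ (if A ∧ B then c *ℤ (if A' ∧ B' then d else + 0) else + 0)
  regroup false A' B B' d = refl
  regroup true false false B' d = refl
  regroup true true false B' d = refl
  regroup true false true B' d = sym (ℤP.*-zeroʳ c)
  regroup true true true false d = sym (ℤP.*-zeroʳ c)
  regroup true true true true d = refl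
  termwise : ∀ n → monoCoeff (mulMono (c , a , b) n) x y ≡ (if (a ≤ᵇ x) ∧ (b ≤ᵇ y) then c *ℤ shifted n else + 0)
  termwise (d , a' , b') =
    trans (cong (λ t → if t then c *ℤ d else + 0) (cong₂ _∧_ (+≡ᵇ-split a a' x) (+≡ᵇ-split b b' y)))
          (regroup (a ≤ᵇ x) (a' ≡ᵇ x ∸ a) (b ≤ᵇ y) (b' ≡ᵇ y ∸ b) d)
  summed : ∀ t → sumℤ (λ n → if t then c *ℤ shifted n else + 0) r
               ≡ (if t then c *ℤ coeff r (x ∸ a) (y ∸ b) else + 0)
  summed true = trans (sumℤ-*ˡ c shifted r) (cong (c *ℤ_) (sym (coeff≡sumℤ r (x ∸ a) (y ∸ b))))
  summed false = sumℤ-zero r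

-- coefficientwise equality ≈P, packaged as a record so that it is handled
-- as an abstract relation (by the algebraic structures and the ring solver)
record _≋_ (p r : Poly) : Set where
  constructor ⟪_⟫
  field un : p ≈P r
open _≋_ public

infix 4 _≋_

coeffwise : ∀ {p r} (f : ℕ → ℕ → ℤ) → (∀ x y → coeff p x y ≡ f x y) → (∀ x y → coeff r x y ≡ f x y) → p ≋ r
coeffwise f eqp eqr = ⟪ (λ x y → trans (eqp x y) (sym (eqr x y))) ⟫

≋-reflexive : ∀ {p r} → p ≡ r → p ≋ r
≋-reflexive refl = ⟪ (λ x y → refl) ⟫

+P-cong : ∀ {p p' r r'} → p ≋ p' → r ≋ r' → (p +P r) ≋ (p' +P r')
+P-cong {p} {p'} {r} {r'} e f = coeffwise (λ x y → coeff p' x y +ℤ coeff r' x y)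
  (λ x y → trans (coeff-++ p r x y) (cong₂ _+ℤ_ (un e x y) (un f x y))) (coeff-++ p' r')

+P-comm : ∀ p r → (p +P r) ≋ (r +P p)
+P-comm p r = coeffwise (λ x y → coeff p x y +ℤ coeff r x y) (coeff-++ p r)
  (λ x y → trans (coeff-++ r p x y) (ℤP.+-comm (coeff r x y) (coeff p x y)))

-P-cong : ∀ {p r} → p ≋ r → (-P p) ≋ (-P r)
-P-cong {p} {r} e = coeffwise (λ x y → - coeff r x y) (λ x y → trans (coeff-neg p x y) (cong -_ (un e x y))) (coeff-neg r)

-P-inverseˡ : ∀ p → ((-P p) +P p) ≋ 0P
-P-inverseˡ p = coeffwise (λ x y → + 0)
  (λ x y → trans (coeff-++ (-P p) p x y) (trans (cong (_+ℤ coeff p x y) (coeff-neg p x y)) (ℤP.+-inverseˡ (coeff p x y))))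
  (λ x y → refl)

*P-congˡ : ∀ p {r r'} → r ≋ r' → (p *P r) ≋ (p *P r')
*P-congˡ p {r} {r'} e = coeffwise (λ x y → sumℤ (λ m → shiftedCoeff m r' x y) p)
  (λ x y → trans (coeff-*P p r x y) (sumℤ-cong (λ m → trans (coeff-mono* m r x y) (shift-cong m x y)) p))
  (λ x y → trans (coeff-*P p r' x y) (sumℤ-cong (λ m → coeff-mono* m r' x y) p))
  where
  shift-cong : ∀ m x y → shiftedCoeff m r x y ≡ shiftedCoeff m r' x y
  shift-cong (c , a , b) x y = cong (λ v → if (a ≤ᵇ x) ∧ (b ≤ᵇ y) then c *ℤ v else + 0) (un e (x ∸ a) (y ∸ b))

*P-comm : ∀ p r → (p *P r) ≋ (r *P p)
*P-comm p r = coeffwise (λ x y → sumℤ (λ n → sumℤ (λ m → monoCoeff (mulMono m n) x y) p) r)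
  (λ x y → trans (coeff-*P p r x y) (sumℤ-swap (λ m n → monoCoeff (mulMono m n) x y) p r))
  (λ x y → trans (coeff-*P r p x y) (sumℤ-cong (λ n → sumℤ-cong (λ m → cong (λ u → monoCoeff u x y) (mulMono-comm n m)) p) r))
  where
  mulMono-comm : ∀ m n → mulMono m n ≡ mulMono n m
  mulMono-comm (c , a , b) (d , a' , b') = cong₂ _,_ (ℤP.*-comm c d) (cong₂ _,_ (ℕP.+-comm a a') (ℕP.+-comm b b'))

*P-assoc : ∀ p r t → ((p *P r) *P t) ≋ (p *P (r *P t))
*P-assoc p r t = coeffwise
  (λ x y → sumℤ (λ m → sumℤ (λ n → sumℤ (λ o → monoCoeff (mulMono m (mulMono n o)) x y) t) r) p)
  (λ x y → trans (coeff-*P (p *P r) t x y)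
    (trans (sumℤ-concatMap (λ u → sumℤ (λ o → monoCoeff (mulMono u o) x y) t) (λ m → map (mulMono m) r) p)
           (sumℤ-cong (λ m → trans (sumℤ-map (λ u → sumℤ (λ o → monoCoeff (mulMono u o) x y) t) (mulMono m) r)
              (sumℤ-cong (λ n → sumℤ-cong (λ o → cong (λ u → monoCoeff u x y) (mulMono-assoc m n o)) t) r)) p)))
  (λ x y → trans (coeff-*P p (r *P t) x y)
    (sumℤ-cong (λ m → trans (sumℤ-concatMap (λ u → monoCoeff (mulMono m u) x y) (λ n → map (mulMono n) t) r)
                             (sumℤ-cong (λ n → sumℤ-map (λ u → monoCoeff (mulMono m u) x y) (mulMono n) t) r)) p))
  where
  mulMono-assoc : ∀ m n o → mulMono (mulMono m n) o ≡ mulMono m (mulMono n o)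
  mulMono-assoc (c , a , b) (d , a' , b') (f , a'' , b'') =
    cong₂ _,_ (ℤP.*-assoc c d f) (cong₂ _,_ (ℕP.+-assoc a a' a'') (ℕP.+-assoc b b' b''))

*P-distribˡ : ∀ p r t → (p *P (r +P t)) ≋ ((p *P r) +P (p *P t))
*P-distribˡ p r t = coeffwise (λ x y → coeff (p *P r) x y +ℤ coeff (p *P t) x y)
  (λ x y → trans (coeff-*P p (r ++ t) x y)
    (trans (sumℤ-cong (λ m → sumℤ-++ _ r t) p)
    (trans (sumℤ-+ _ _ p) (sym (cong₂ _+ℤ_ (coeff-*P p r x y) (coeff-*P p t x y))))))
  (coeff-++ (p *P r) (p *P t))

*P-identityˡ : ∀ p → (1P *P p) ≋ p
*P-identityˡ p = coeffwise (coeff p)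
  (λ x y → trans (coeff-*P 1P p x y) (trans (ℤP.+-identityʳ _)
    (trans (sumℤ-cong (λ n → cong (λ u → monoCoeff u x y) (one* n)) p) (sym (coeff≡sumℤ p x y)))))
  (λ x y → refl)
  where
  one* : ∀ n → mulMono (+ 1 , 0 , 0) n ≡ n
  one* (d , a , b) = cong (_, a , b) (ℤP.*-identityˡ d)

PolyRing : CommutativeRing 0ℓ 0ℓ
PolyRing = record
  { Carrier = Poly ; _≈_ = _≋_ ; _+_ = _+P_ ; _*_ = _*P_ ; -_ = -P_ ; 0# = 0P ; 1# = 1P
  ; isCommutativeRing = record
    { isRing = record
      { +-isAbelianGroup = record
        { isGroup = record
          { isMonoid = record
            { isSemigroup = record
              { isMagma = record { isEquivalence = ≋-isEquivalence ; ∙-cong = +P-cong }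
              ; assoc = λ p r t → ≋-reflexive (ListP.++-assoc p r t) }
            ; identity = (λ p → ≋-reflexive refl) , (λ p → ≋-reflexive (ListP.++-identityʳ p)) }
          ; inverse = -P-inverseˡ , (λ p → ≋-trans (+P-comm p (-P p)) (-P-inverseˡ p))
          ; ⁻¹-cong = -P-cong }
        ; comm = +P-comm }
      ; *-cong = λ {p} {p'} {r} {r'} e f →
          ≋-trans (*P-congˡ p f) (≋-trans (*P-comm p r') (≋-trans (*P-congˡ r' e) (*P-comm r' p')))
      ; *-assoc = *P-assoc
      ; *-identity = *P-identityˡ , (λ p → ≋-trans (*P-comm p 1P) (*P-identityˡ p))
      ; distrib = *P-distribˡ
        , (λ p r t → ≋-trans (*P-comm (r +P t) p) (≋-trans (*P-distribˡ p r t) (+P-cong (*P-comm p r) (*P-comm p t)))) }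
    ; *-comm = *P-comm } }
  where
  ≋-trans : ∀ {p r t} → p ≋ r → r ≋ t → p ≋ t
  ≋-trans e f = ⟪ (λ x y → trans (un e x y) (un f x y)) ⟫
  ≋-isEquivalence : IsEquivalence _≋_
  ≋-isEquivalence = record
    { refl = ≋-reflexive refl ; sym = λ e → ⟪ (λ x y → sym (un e x y)) ⟫ ; trans = ≋-trans }

-- Zero test for the ring solver: p ≋ 0P as soon as the coefficient of every
-- monomial occurring in p vanishes (coefficients elsewhere are 0 anyway).
VanishesOn : Poly → Poly → Set
VanishesOn p [] = ⊤
VanishesOn p ((c , a , b) ∷ ms) = (coeff p a b ≡ + 0) × VanishesOn p ms

vanishesOn? : ∀ p ms → Maybe (VanishesOn p ms)
vanishesOn? p [] = just tt
vanishesOn? p ((c , a , b) ∷ ms) with coeff p a b ℤP.≟ + 0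
... | yes eq = Maybe.map (eq ,_) (vanishesOn? p ms)
... | no _ = nothing

vanishes-elsewhere : ∀ p ms x y → VanishesOn p ms → coeff ms x y ≢ + 0 → coeff p x y ≡ + 0
vanishes-elsewhere p [] x y tt ne = ⊥-elim (ne refl)
vanishes-elsewhere p ((c , a , b) ∷ ms) x y (here , rest) ne with a ≡ᵇ x in ax | b ≡ᵇ y in by
... | true | true = subst₂ (λ u v → coeff p u v ≡ + 0)
  (ℕP.≡ᵇ⇒≡ a x (subst T (sym ax) tt)) (ℕP.≡ᵇ⇒≡ b y (subst T (sym by) tt)) here
... | true | false = vanishes-elsewhere p ms x y rest (λ z → ne (trans (ℤP.+-identityˡ _) z))
... | false | true = vanishes-elsewhere p ms x y rest (λ z → ne (trans (ℤP.+-identityˡ _) z))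
... | false | false = vanishes-elsewhere p ms x y rest (λ z → ne (trans (ℤP.+-identityˡ _) z))

isZero? : ∀ p → Maybe (0P ≋ p)
isZero? p = Maybe.map zero-if (vanishesOn? p p)
  where
  zero-if : VanishesOn p p → 0P ≋ p
  zero-if v = ⟪ (λ x y → sym (zero-at x y)) ⟫
    where
    zero-at : ∀ x y → coeff p x y ≡ + 0
    zero-at x y with coeff p x y ℤP.≟ + 0
    ... | yes e = e
    ... | no ne = vanishes-elsewhere p p x y v ne

PolySolverRing : AlmostCommutativeRing 0ℓ 0ℓ
PolySolverRing = fromCommutativeRing PolyRing isZero?

module R = CommutativeRing PolyRing
open R using (+-cong; *-cong) renaming (refl to ≋-refl; sym to ≋-sym; trans to ≋-trans)
module ≋-Reasoning = Relation.Binary.Reasoning.Setoid R.setoid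
open import Algebra.Properties.CommutativeSemigroup R.*-commutativeSemigroup
  using () renaming (interchange to *P-interchange)
open import Algebra.Properties.CommutativeSemigroup R.+-commutativeSemigroup
  using () renaming (interchange to +P-interchange)

-- Fractions up to a common factor.

-- F ≽ G : F = (k · num G) / (k · den G) for some polynomial k.  Unlike ≈F,
-- this is transitive with no hypothesis on denominators.
record _≽_ (F G : Frac) : Set where
  constructor scaledBy
  field
    factor : Poly
    num≋ : num F ≋ factor *P num G
    den≋ : den F ≋ factor *P den G
open _≽_

infix 4 _≽_

≽-refl : ∀ {F} → F ≽ F
≽-refl {a / b} = scaledBy 1P (≋-sym (R.*-identityˡ a)) (≋-sym (R.*-identityˡ b))

≽-trans : ∀ {F G H} → F ≽ G → G ≽ H → F ≽ H
≽-trans {H = e / f} (scaledBy k n₁ d₁) (scaledBy l n₂ d₂) =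
  scaledBy (k *P l) (≋-trans n₁ (≋-trans (*P-congˡ k n₂) (≋-sym (R.*-assoc k l e))))
                    (≋-trans d₁ (≋-trans (*P-congˡ k d₂) (≋-sym (R.*-assoc k l f))))

≡⇒≽ : ∀ {F G} → F ≡ G → F ≽ G
≡⇒≽ refl = ≽-refl

≽-preorder : Preorder 0ℓ 0ℓ 0ℓ
≽-preorder = record
  { Carrier = Frac ; _≈_ = _≡_ ; _≲_ = _≽_
  ; isPreorder = record { isEquivalence = isEquivalence ; reflexive = ≡⇒≽ ; trans = ≽-trans } }

module ≽-Reasoning = Relation.Binary.Reasoning.Preorder ≽-preorder

poly-≽ : ∀ {p p'} → p ≋ p' → poly p ≽ poly p'
poly-≽ {p' = p'} e = scaledBy 1P (≋-trans e (≋-sym (R.*-identityˡ p'))) ≋-refl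

≽-≈F : ∀ {F G H} → F ≽ G → G ≈F H → F ≈F H
≽-≈F {a / b} {c / d} {e / f} (scaledBy k n₁ d₁) G≈H = un (begin
  a *P f          ≈⟨ *-cong n₁ ≋-refl ⟩
  (k *P c) *P f   ≈⟨ R.*-assoc k c f ⟩
  k *P (c *P f)   ≈⟨ *P-congˡ k ⟪ G≈H ⟫ ⟩
  k *P (e *P d)   ≈⟨ swap k e d ⟩
  e *P (k *P d)   ≈⟨ *P-congˡ e (≋-sym d₁) ⟩
  e *P b          ∎)
  where
  open ≋-Reasoning
  swap : ∀ k e d → k *P (e *P d) ≋ e *P (k *P d)
  swap = solve-∀ PolySolverRing

+F-cong : ∀ {F F' G G'} → F ≽ F' → G ≽ G' → (F +F G) ≽ (F' +F G')
+F-cong {a / b} {a' / b'} {c / d} {c' / d'} (scaledBy k n₁ d₁) (scaledBy l n₂ d₂) = scaledBy (k *P l)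
  (≋-trans (+-cong (*-cong n₁ d₂) (*-cong n₂ d₁)) (factor-out k l a' d' c' b'))
  (≋-trans (*-cong d₁ d₂) (*P-interchange k b' l d'))
  where
  factor-out : ∀ k l a d c b → ((k *P a) *P (l *P d)) +P ((l *P c) *P (k *P b)) ≋ (k *P l) *P ((a *P d) +P (c *P b))
  factor-out = solve-∀ PolySolverRing

*F-cong : ∀ {F F' G G'} → F ≽ F' → G ≽ G' → (F *F G) ≽ (F' *F G')
*F-cong {a / b} {a' / b'} {c / d} {c' / d'} (scaledBy k n₁ d₁) (scaledBy l n₂ d₂) = scaledBy (k *P l)
  (≋-trans (*-cong n₁ n₂) (*P-interchange k a' l c'))
  (≋-trans (*-cong d₁ d₂) (*P-interchange k b' l d'))

÷F-cong : ∀ {F F' G G'} → F ≽ F' → G ≽ G' → (F ÷F G) ≽ (F' ÷F G')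
÷F-cong {a / b} {a' / b'} {c / d} {c' / d'} (scaledBy k n₁ d₁) (scaledBy l n₂ d₂) = scaledBy (k *P l)
  (≋-trans (*-cong n₁ d₂) (*P-interchange k a' l d'))
  (≋-trans (*-cong d₁ n₂) (*P-interchange k b' l c'))

Vanishes : Frac → Set
Vanishes F = num F ≋ 0P

vanishes-+F : ∀ {F G} → Vanishes F → Vanishes G → Vanishes (F +F G)
vanishes-+F {a / b} {c / d} z₁ z₂ =
  ≋-trans (+-cong (≋-trans (*-cong z₁ ≋-refl) (R.zeroˡ d)) (≋-trans (*-cong z₂ ≋-refl) (R.zeroˡ b))) (R.+-identityˡ 0P)

vanishes-*Fˡ : ∀ {F G} → Vanishes F → Vanishes (F *F G)
vanishes-*Fˡ {a / b} {c / d} z = ≋-trans (*-cong z ≋-refl) (R.zeroˡ c)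

vanishes-*Fʳ : ∀ {F G} → Vanishes G → Vanishes (F *F G)
vanishes-*Fʳ {a / b} {c / d} z = ≋-trans (*P-congˡ a z) (R.zeroʳ a)

+F-vanishingʳ : ∀ {F G} → Vanishes G → (F +F G) ≽ F
+F-vanishingʳ {a / b} {c / d} z = scaledBy d
  (≋-trans (+-cong ≋-refl (≋-trans (*-cong z ≋-refl) (R.zeroˡ b))) (≋-trans (R.+-identityʳ (a *P d)) (R.*-comm a d)))
  (R.*-comm b d)

+F-vanishingˡ : ∀ {F G} → Vanishes F → (F +F G) ≽ G
+F-vanishingˡ {a / b} {c / d} z = scaledBy b
  (≋-trans (+-cong (≋-trans (*-cong z ≋-refl) (R.zeroˡ d)) ≋-refl) (≋-trans (R.+-identityˡ (c *P b)) (R.*-comm c b)))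
  ≋-refl

vanishes⇒≈0F : ∀ {F} → Vanishes F → F ≈F 0F
vanishes⇒≈0F {a / b} z = un (≋-trans (R.*-identityʳ a) (≋-trans z (≋-sym (R.zeroˡ b))))

-- Part (1): evaluation at w = s = 0 shows that λ(j) is not zero.

const : Poly → ℤ
const p = coeff p 0 0

const-+P : ∀ p r → const (p +P r) ≡ const p +ℤ const r
const-+P p r = coeff-++ p r 0 0

const-*P : ∀ p r → const (p *P r) ≡ const p *ℤ const r
const-*P p r = begin
  const (p *P r)                                 ≡⟨ coeff-*P p r 0 0 ⟩
  sumℤ (λ m → sumℤ (λ n → monoCoeff (mulMono m n) 0 0) r) p
    ≡⟨ sumℤ-cong (λ m → trans (coeff-mono* m r 0 0) (atOrigin m)) p ⟩
  sumℤ (λ m → const r *ℤ monoCoeff m 0 0) p      ≡⟨ sumℤ-*ˡ (const r) (λ m → monoCoeff m 0 0) p ⟩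
  const r *ℤ sumℤ (λ m → monoCoeff m 0 0) p      ≡⟨ cong (const r *ℤ_) (sym (coeff≡sumℤ p 0 0)) ⟩
  const r *ℤ const p                             ≡⟨ ℤP.*-comm (const r) (const p) ⟩
  const p *ℤ const r                             ∎
  where
  open ≡-Reasoning
  atOrigin : ∀ m → shiftedCoeff m r 0 0 ≡ const r *ℤ monoCoeff m 0 0
  atOrigin (c , zero , zero) = ℤP.*-comm c (const r)
  atOrigin (c , zero , suc b) = sym (ℤP.*-zeroʳ (const r))
  atOrigin (c , suc a , b) = sym (ℤP.*-zeroʳ (const r))

-- a fraction whose denominator is 1 at the origin has a well-defined value there
ValueAtOrigin : Frac → ℤ → Set
ValueAtOrigin F c = (const (den F) ≡ + 1) × (const (num F) ≡ c)

valueAtOrigin-+F : ∀ {F G a b} → ValueAtOrigin F a → ValueAtOrigin G b → ValueAtOrigin (F +F G) (a +ℤ b)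
valueAtOrigin-+F {n₁ / d₁} {n₂ / d₂} {a} {b} (d₁≡1 , n₁≡a) (d₂≡1 , n₂≡b) =
  trans (const-*P d₁ d₂) (cong₂ _*ℤ_ d₁≡1 d₂≡1) ,
  trans (const-+P (n₁ *P d₂) (n₂ *P d₁))
    (cong₂ _+ℤ_ (trans (const-*P n₁ d₂) (trans (cong₂ _*ℤ_ n₁≡a d₂≡1) (ℤP.*-identityʳ a)))
                (trans (const-*P n₂ d₁) (trans (cong₂ _*ℤ_ n₂≡b d₁≡1) (ℤP.*-identityʳ b))))

valueAtOrigin-*F : ∀ {F G a b} → ValueAtOrigin F a → ValueAtOrigin G b → ValueAtOrigin (F *F G) (a *ℤ b)
valueAtOrigin-*F {n₁ / d₁} {n₂ / d₂} (d₁≡1 , n₁≡a) (d₂≡1 , n₂≡b) =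
  trans (const-*P d₁ d₂) (cong₂ _*ℤ_ d₁≡1 d₂≡1) , trans (const-*P n₁ n₂) (cong₂ _*ℤ_ n₁≡a n₂≡b)

const-qPoch : ∀ m → const (qPoch m) ≡ + 1
const-qPoch zero = refl
const-qPoch (suc m) = trans (const-*P (qPoch m) _) (cong (_*ℤ + 1) (const-qPoch m))

valueAtOrigin-qbinom : ∀ n k → ValueAtOrigin (qbinom n k) (+ 1)
valueAtOrigin-qbinom n k =
  trans (const-*P (qPoch k) (qPoch (n ∸ k))) (cong₂ _*ℤ_ (const-qPoch k) (const-qPoch (n ∸ k))) , const-qPoch n

zkMono : ℕ → Poly
zkMono k = (negOnePow k , 2 *ℕ k , 2 *ℕ (k *ℕ (k ∸ 1))) ∷ []

lamTerm : ℕ → ℕ → Frac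
lamTerm j k = qbinom (j ∸ k) k *F poly (zkMono k)

-- only the k = 0 summand contributes at the origin (z^k vanishes there for k > 0)
valueAtOrigin-lamTerm₀ : ∀ j → ValueAtOrigin (lamTerm j 0) (+ 1)
valueAtOrigin-lamTerm₀ j = valueAtOrigin-*F {qbinom j 0} {poly (zkMono 0)} (valueAtOrigin-qbinom j 0) (refl , refl)

valueAtOrigin-lamTermₛ : ∀ j k → ValueAtOrigin (lamTerm j (suc k)) (+ 0)
valueAtOrigin-lamTermₛ j k =
  subst (ValueAtOrigin (lamTerm j (suc k))) (ℤP.*-zeroʳ (+ 1))
        (valueAtOrigin-*F {qbinom (j ∸ suc k) (suc k)} {poly (zkMono (suc k))}
           (valueAtOrigin-qbinom (j ∸ suc k) (suc k)) (refl , refl))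

valueAtOrigin-sumTo : ∀ n f → ValueAtOrigin (f 0) (+ 1) → (∀ k → ValueAtOrigin (f (suc k)) (+ 0)) →
  ValueAtOrigin (sumTo (suc n) f) (+ 1)
valueAtOrigin-sumTo zero f v₀ vₛ = valueAtOrigin-+F {0F} {f 0} (refl , refl) v₀
valueAtOrigin-sumTo (suc n) f v₀ vₛ =
  valueAtOrigin-+F {sumTo (suc n) f} {f (suc n)} (valueAtOrigin-sumTo n f v₀ vₛ) (vₛ n)

lam≉0 : ∀ j → ¬ (lam j ≈F 0F)
lam≉0 j lam≈0 = 1≢0 (trans (sym value) (lam≈0 0 0))
  where
  1≢0 : + 1 ≢ + 0
  1≢0 ()
  value : const (num (lam j) *P 1P) ≡ + 1
  value = trans (const-*P (num (lam j)) 1P) (cong (_*ℤ + 1) (proj₂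
    (valueAtOrigin-sumTo ⌊ j /2⌋ (lamTerm j) (valueAtOrigin-lamTerm₀ j) (valueAtOrigin-lamTermₛ j))))

-- The Gaussian binomials are polynomials in q.

qPow : ℕ → Poly
qPow m = (+ 1 , 0 , 2 *ℕ m) ∷ []

qPow-+ : ∀ a b → qPow a *P qPow b ≋ qPow (a +ℕ b)
qPow-+ a b = ≋-reflexive (cong (λ e → (+ 1 , 0 , e) ∷ []) (sym (ℕP.*-distribˡ-+ 2 a b)))

-- [n k]_q as a polynomial, defined by the q-Pascal rule
--   [n+1 k+1] = [n k+1] + q^{n-k} [n k] ;  it vanishes for k > n.
qbin : ℕ → ℕ → Poly
qbin n zero = 1P
qbin zero (suc k) = 0P
qbin (suc n) (suc k) = qbin n (suc k) +P (qPow (n ∸ k) *P qbin n k)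

qbin-vanish : ∀ n k → n < k → qbin n k ≋ 0P
qbin-vanish zero (suc k) n<k = ≋-refl
qbin-vanish (suc n) (suc k) (s≤s n<k) =
  ≋-trans (+-cong (qbin-vanish n (suc k) (ℕP.m<n⇒m<1+n n<k))
                  (≋-trans (*P-congˡ (qPow (n ∸ k)) (qbin-vanish n k n<k)) (R.zeroʳ (qPow (n ∸ k)))))
          (R.+-identityˡ 0P)

qbin-diag : ∀ n → qbin n n ≋ 1P
qbin-diag zero = ≋-refl
qbin-diag (suc n) rewrite ℕP.n∸n≡0 n =
  ≋-trans (+-cong (qbin-vanish n (suc n) (ℕP.n<1+n n)) (≋-trans (R.*-identityˡ (qbin n n)) (qbin-diag n)))
          (R.+-identityˡ 1P)

qPoch-split : ∀ k r → qPoch (k +ℕ r) ≋ qbin (k +ℕ r) k *P (qPoch k *P qPoch r)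
qPoch-split zero r = ≋-sym (≋-trans (R.*-identityˡ _) (R.*-identityˡ (qPoch r)))
qPoch-split (suc k) zero =
  subst (λ m → qPoch m ≋ qbin m (suc k) *P (qPoch (suc k) *P 1P)) (sym (ℕP.+-identityʳ (suc k)))
    (≋-sym (≋-trans (*-cong (qbin-diag (suc k)) (R.*-identityʳ (qPoch (suc k)))) (R.*-identityˡ (qPoch (suc k)))))
qPoch-split (suc k) (suc r) = begin
  qPoch n *P (1P +P (-P qPow (suc n)))
    ≈⟨ *P-congˡ (qPoch n) (+-cong (≋-refl {1P}) (R.-‿cong (≋-sym exponents))) ⟩
  qPoch n *P (1P +P (-P (A *P B)))
    ≈⟨ split-factor (qPoch n) A B ⟩
  (qPoch n *P (1P +P (-P A))) +P (A *P (qPoch n *P (1P +P (-P B))))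
    ≈⟨ +-cong (*-cong IH₁ ≋-refl) (*P-congˡ A (*-cong IH₂ ≋-refl)) ⟩
  ((g₁ *P (qPoch (suc k) *P qPoch r)) *P (1P +P (-P A))) +P (A *P ((g₀ *P (qPoch k *P qPoch (suc r))) *P (1P +P (-P B))))
    ≈⟨ regroup g₁ g₀ A B (qPoch k) (qPoch r) ⟩
  (g₁ +P (A *P g₀)) *P (qPoch (suc k) *P qPoch (suc r))
    ≡⟨ cong (λ e → (g₁ +P (qPow e *P g₀)) *P (qPoch (suc k) *P qPoch (suc r))) (sym (ℕP.m+n∸m≡n k (suc r))) ⟩
  qbin (suc n) (suc k) *P (qPoch (suc k) *P qPoch (suc r))
    ∎
  where
  open ≋-Reasoning
  n = k +ℕ suc r
  A = qPow (suc r)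
  B = qPow (suc k)
  g₁ = qbin n (suc k)
  g₀ = qbin n k
  exponents : A *P B ≋ qPow (suc n)
  exponents = ≋-trans (qPow-+ (suc r) (suc k))
    (≋-reflexive (cong (λ e → qPow (suc e)) (trans (ℕP.+-comm r (suc k)) (sym (ℕP.+-suc k r)))))
  IH₁ : qPoch n ≋ g₁ *P (qPoch (suc k) *P qPoch r)
  IH₁ = subst (λ m → qPoch m ≋ qbin m (suc k) *P (qPoch (suc k) *P qPoch r)) (sym (ℕP.+-suc k r)) (qPoch-split (suc k) r)
  IH₂ : qPoch n ≋ g₀ *P (qPoch k *P qPoch (suc r))
  IH₂ = qPoch-split k (suc r)
  split-factor : ∀ Q A B → Q *P (1P +P (-P (A *P B))) ≋ (Q *P (1P +P (-P A))) +P (A *P (Q *P (1P +P (-P B))))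
  split-factor = solve-∀ PolySolverRing
  regroup : ∀ g₁ g₀ A B qk qr →
    ((g₁ *P ((qk *P (1P +P (-P B))) *P qr)) *P (1P +P (-P A))) +P (A *P ((g₀ *P (qk *P (qr *P (1P +P (-P A))))) *P (1P +P (-P B))))
      ≋ (g₁ +P (A *P g₀)) *P ((qk *P (1P +P (-P B))) *P (qr *P (1P +P (-P A))))
  regroup = solve-∀ PolySolverRing

qbinom≽qbin : ∀ n k → k ≤ n → qbinom n k ≽ poly (qbin n k)
qbinom≽qbin n k k≤n with r , refl ← ℕP.m≤n⇒∃[o]m+o≡n k≤n rewrite ℕP.m+n∸m≡n k r =
  scaledBy (qPoch k *P qPoch r)
    (≋-trans (qPoch-split k r) (R.*-comm (qbin (k +ℕ r) k) _))
    (≋-sym (R.*-identityʳ _))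

-- λ(j) as a polynomial: the continuants of M.

offDiag : ℕ → Poly
offDiag t = ((+ 1 , 1 , 0) ∷ []) *P ((+ 1 , 0 , t) ∷ [])

negOffDiag² : ℕ → Poly
negOffDiag² t = -P (offDiag t *P offDiag t)

-- the leading principal minors of M, by cofactor expansion along the last row
Λ : ℕ → Poly
Λ 0 = 1P
Λ 1 = 1P
Λ (suc (suc t)) = Λ (suc t) +P (negOffDiag² t *P Λ t)

sumP : ℕ → (ℕ → Poly) → Poly
sumP zero f = 0P
sumP (suc n) f = sumP n f +P f n

sumP-cong : ∀ n {f g} → (∀ k → f k ≋ g k) → sumP n f ≋ sumP n g
sumP-cong zero eq = ≋-refl
sumP-cong (suc n) eq = +-cong (sumP-cong n eq) (eq n)

sumP-+ : ∀ n f g → sumP n (λ k → f k +P g k) ≋ sumP n f +P sumP n g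
sumP-+ zero f g = ≋-sym (R.+-identityˡ 0P)
sumP-+ (suc n) f g = ≋-trans (+-cong (sumP-+ n f g) ≋-refl) (+P-interchange (sumP n f) (sumP n g) (f n) (g n))

sumP-*ˡ : ∀ n c f → sumP n (λ k → c *P f k) ≋ c *P sumP n f
sumP-*ˡ zero c f = ≋-sym (R.zeroʳ c)
sumP-*ˡ (suc n) c f = ≋-trans (+-cong (sumP-*ˡ n c f) ≋-refl) (≋-sym (R.distribˡ c (sumP n f) (f n)))

sumP-shift : ∀ n f → sumP (suc n) f ≋ f 0 +P sumP n (λ k → f (suc k))
sumP-shift zero f = ≋-trans (R.+-identityˡ (f 0)) (≋-sym (R.+-identityʳ (f 0)))
sumP-shift (suc n) f = ≋-trans (+-cong (sumP-shift n f) ≋-refl) (R.+-assoc (f 0) _ (f (suc n)))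

sumP-extend : ∀ f m n → (∀ k → m ≤ k → f k ≋ 0P) → m ≤ n → sumP n f ≋ sumP m f
sumP-extend f m zero vanish z≤n = ≋-refl
sumP-extend f m (suc n) vanish m≤1+n with m ℕP.≤? n
... | yes m≤n = ≋-trans (+-cong (sumP-extend f m n vanish m≤n) (vanish n m≤n)) (R.+-identityʳ (sumP m f))
... | no m≰n rewrite ℕP.≤-antisym m≤1+n (ℕP.≰⇒> m≰n) = ≋-refl

≤⌊/2⌋⇒+≤ : ∀ {k j} → k ≤ ⌊ j /2⌋ → k +ℕ k ≤ j
≤⌊/2⌋⇒+≤ {k} {j} k≤ = ℕP.≤-trans (ℕP.+-mono-≤ k≤ (ℕP.≤-trans k≤ (ℕP.⌊n/2⌋≤⌈n/2⌉ j))) (ℕP.≤-reflexive (ℕP.⌊n/2⌋+⌈n/2⌉≡n j))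

⌊/2⌋<⇒<+ : ∀ {k j} → ⌊ j /2⌋ < k → j < k +ℕ k
⌊/2⌋<⇒<+ {k} {j} <k = ℕP.≰⇒> (λ k+k≤j → ℕP.<⇒≱ <k (subst (_≤ ⌊ j /2⌋) (sym (ℕP.n≡⌊n+n/2⌋ k)) (ℕP.⌊n/2⌋-mono k+k≤j)))

lamTermP : ℕ → ℕ → Poly
lamTermP j k = qbin (j ∸ k) k *P zkMono k

qbin-vanish-half : ∀ j k → j < k +ℕ k → qbin (j ∸ k) k ≋ 0P
qbin-vanish-half j zero ()
qbin-vanish-half j (suc k) j<2k = qbin-vanish (j ∸ suc k) (suc k) (ℕP.m<n+o⇒m∸n<o j (suc k) j<2k)

lamTermP-vanish : ∀ j k → j < k +ℕ k → lamTermP j k ≋ 0P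
lamTermP-vanish j k j<2k = ≋-trans (*-cong (qbin-vanish-half j k j<2k) ≋-refl) (R.zeroˡ (zkMono k))

lamP : ℕ → Poly
lamP j = sumP (suc j) (lamTermP j)

poly-+F : ∀ p r → (poly p +F poly r) ≽ poly (p +P r)
poly-+F p r = scaledBy 1P (distrib p r) ≋-refl
  where
  distrib : ∀ p r → (p *P 1P) +P (r *P 1P) ≋ 1P *P (p +P r)
  distrib = solve-∀ PolySolverRing

poly-*F : ∀ p r → (poly p *F poly r) ≽ poly (p *P r)
poly-*F p r = scaledBy 1P (≋-sym (R.*-identityˡ (p *P r))) ≋-refl

sumTo≽sumP : ∀ n f g → (∀ k → k < n → f k ≽ poly (g k)) → sumTo n f ≽ poly (sumP n g)
sumTo≽sumP zero f g termwise = ≽-refl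
sumTo≽sumP (suc n) f g termwise =
  ≽-trans (+F-cong (sumTo≽sumP n f g (λ k k<n → termwise k (ℕP.m<n⇒m<1+n k<n))) (termwise n ℕP.≤-refl))
          (poly-+F (sumP n g) (g n))

lam≽lamP : ∀ j → lam j ≽ poly (lamP j)
lam≽lamP j = ≽-trans (sumTo≽sumP (suc ⌊ j /2⌋) (lamTerm j) (lamTermP j) term≽)
  (poly-≽ (≋-sym (sumP-extend (lamTermP j) (suc ⌊ j /2⌋) (suc j)
    (λ k <k → lamTermP-vanish j k (⌊/2⌋<⇒<+ <k)) (s≤s (ℕP.⌊n/2⌋≤n j)))))
  where
  term≽ : ∀ k → k < suc ⌊ j /2⌋ → lamTerm j k ≽ poly (lamTermP j k)
  term≽ k (s≤s k≤) = ≽-trans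
    (*F-cong (qbinom≽qbin (j ∸ k) k (ℕP.m+n≤o⇒m≤o∸n k (≤⌊/2⌋⇒+≤ k≤))) (≽-refl {poly (zkMono k)}))
    (poly-*F (qbin (j ∸ k) k) (zkMono k))

-- q-Pascal in the shape needed for the λ-recursion (for k > j both sides are 0)
qbin-pascal : ∀ j k → qbin (suc j ∸ k) (suc k) ≋ qbin (j ∸ k) (suc k) +P (qPow (j ∸ k ∸ k) *P qbin (j ∸ k) k)
qbin-pascal j k with k ℕP.≤? j
... | yes k≤j rewrite ℕP.+-∸-assoc 1 k≤j = ≋-refl
qbin-pascal j zero | no 0≰j = ⊥-elim (0≰j z≤n)
qbin-pascal j (suc k) | no k≰j
  rewrite ℕP.m≤n⇒m∸n≡0 (ℕP.≤-pred (ℕP.≰⇒> k≰j)) | ℕP.m≤n⇒m∸n≡0 (ℕP.<⇒≤ (ℕP.≰⇒> k≰j)) = ≋-refl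

zkMono-step : ∀ j k → k +ℕ k ≤ j → qPow (j ∸ k ∸ k) *P zkMono (suc k) ≋ negOffDiag² j *P zkMono k
zkMono-step j k 2k≤j with r , refl ← ℕP.m≤n⇒∃[o]m+o≡n 2k≤j =
  ≋-reflexive (cong (_∷ []) (cong₂ _,_ sign (cong₂ _,_ (ℕP.*-suc 2 k) sExponent)))
  where
  sign : + 1 *ℤ (- negOnePow k) ≡ - (+ 1) *ℤ negOnePow k
  sign = trans (ℤP.*-identityˡ (- negOnePow k)) (sym (ℤP.-1*i≡-i (negOnePow k)))
  -- with j = 2k + r the s-exponents are 2r + 2(k+1)k = 2j + 2k(k−1)
  sExponent : 2 *ℕ (k +ℕ k +ℕ r ∸ k ∸ k) +ℕ 2 *ℕ (suc k *ℕ k)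
            ≡ (k +ℕ k +ℕ r) +ℕ (k +ℕ k +ℕ r) +ℕ 2 *ℕ (k *ℕ (k ∸ 1))
  sExponent = trans (cong (λ e → 2 *ℕ e +ℕ 2 *ℕ (suc k *ℕ k)) remainder) (exponents k r)
    where
    remainder : k +ℕ k +ℕ r ∸ k ∸ k ≡ r
    remainder = trans (ℕP.∸-+-assoc (k +ℕ k +ℕ r) k k) (ℕP.m+n∸m≡n (k +ℕ k) r)
    exponents : ∀ k r → 2 *ℕ r +ℕ 2 *ℕ (suc k *ℕ k) ≡ (k +ℕ k +ℕ r) +ℕ (k +ℕ k +ℕ r) +ℕ 2 *ℕ (k *ℕ (k ∸ 1))
    exponents zero = exponents₀
      where
      exponents₀ : ∀ r → 2 *ℕ r +ℕ 2 *ℕ (1 *ℕ 0) ≡ (0 +ℕ 0 +ℕ r) +ℕ (0 +ℕ 0 +ℕ r) +ℕ 2 *ℕ (0 *ℕ 0)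
      exponents₀ = ℕ-solve
    exponents (suc t) = exponentsₛ t
      where
      exponentsₛ : ∀ t r → 2 *ℕ r +ℕ 2 *ℕ (suc (suc t) *ℕ suc t)
                           ≡ (suc t +ℕ suc t +ℕ r) +ℕ (suc t +ℕ suc t +ℕ r) +ℕ 2 *ℕ (suc t *ℕ t)
      exponentsₛ = ℕ-solve

-- each summand of λ(j+2) splits by q-Pascal into summands of λ(j+1) and λ(j)
lamTermP-step : ∀ j k → lamTermP (suc (suc j)) (suc k) ≋ lamTermP (suc j) (suc k) +P (negOffDiag² j *P lamTermP j k)
lamTermP-step j k = begin
  qbin (suc j ∸ k) (suc k) *P zkMono (suc k)
    ≈⟨ *-cong (qbin-pascal j k) ≋-refl ⟩
  (qbin (j ∸ k) (suc k) +P (Q *P g)) *P zkMono (suc k)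
    ≈⟨ R.distribʳ (zkMono (suc k)) (qbin (j ∸ k) (suc k)) (Q *P g) ⟩
  lamTermP (suc j) (suc k) +P ((Q *P g) *P zkMono (suc k))
    ≈⟨ +-cong ≋-refl shifted ⟩
  lamTermP (suc j) (suc k) +P (negOffDiag² j *P lamTermP j k)
    ∎
  where
  open ≋-Reasoning
  Q = qPow (j ∸ k ∸ k)
  g = qbin (j ∸ k) k
  shifted : (Q *P g) *P zkMono (suc k) ≋ negOffDiag² j *P lamTermP j k
  shifted with (k +ℕ k) ℕP.≤? j
  ... | yes 2k≤j = ≋-trans (swap Q g (zkMono (suc k)))
                   (≋-trans (*-cong (zkMono-step j k 2k≤j) ≋-refl) (reassoc (negOffDiag² j) (zkMono k) g))
    where
    swap : ∀ Q g z → (Q *P g) *P z ≋ (Q *P z) *P g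
    swap = solve-∀ PolySolverRing
    reassoc : ∀ c z g → (c *P z) *P g ≋ c *P (g *P z)
    reassoc = solve-∀ PolySolverRing
  ... | no 2k≰j = ≋-trans (≋-trans (*-cong (≋-trans (*P-congˡ Q g≋0) (R.zeroʳ Q)) ≋-refl) (R.zeroˡ (zkMono (suc k))))
                         (≋-sym (≋-trans (*P-congˡ (negOffDiag² j) (lamTermP-vanish j k j<2k)) (R.zeroʳ (negOffDiag² j))))
    where
    j<2k : j < k +ℕ k
    j<2k = ℕP.≰⇒> 2k≰j
    g≋0 : g ≋ 0P
    g≋0 = qbin-vanish-half j k j<2k

lamP-extend : ∀ j n → j ≤ n → sumP (suc n) (lamTermP j) ≋ lamP j
lamP-extend j n j≤n = sumP-extend (lamTermP j) (suc j) (suc n)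
  (λ k j<k → lamTermP-vanish j k (ℕP.≤-trans j<k (ℕP.m≤m+n k k))) (s≤s j≤n)

lamP-rec : ∀ j → lamP (suc (suc j)) ≋ lamP (suc j) +P (negOffDiag² j *P lamP j)
lamP-rec j = begin
  sumP (suc n) (lamTermP (suc (suc j)))
    ≈⟨ sumP-shift n (lamTermP (suc (suc j))) ⟩
  head +P sumP n (λ k → lamTermP (suc (suc j)) (suc k))
    ≈⟨ +-cong (≋-refl {head}) (sumP-cong n (lamTermP-step j)) ⟩
  head +P sumP n (λ k → lamTermP (suc j) (suc k) +P (c *P lamTermP j k))
    ≈⟨ +-cong (≋-refl {head}) (≋-trans (sumP-+ n (λ k → lamTermP (suc j) (suc k)) (λ k → c *P lamTermP j k))
                                        (+-cong (≋-refl {tail}) (sumP-*ˡ n c (lamTermP j)))) ⟩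
  head +P (tail +P (c *P sumP n (lamTermP j)))
    ≈⟨ ≋-sym (R.+-assoc head tail (c *P sumP n (lamTermP j))) ⟩
  (head +P tail) +P (c *P sumP n (lamTermP j))
    ≈⟨ +-cong (≋-sym (sumP-shift n (lamTermP (suc j)))) (≋-refl {c *P sumP n (lamTermP j)}) ⟩
  sumP (suc n) (lamTermP (suc j)) +P (c *P sumP n (lamTermP j))
    ≈⟨ +-cong (lamP-extend (suc j) n (ℕP.n≤1+n (suc j))) (*P-congˡ c (lamP-extend j (suc j) (ℕP.n≤1+n j))) ⟩
  lamP (suc j) +P (c *P lamP j)
    ∎
  where
  open ≋-Reasoning
  n = suc (suc j)
  c = negOffDiag² j
  -- the k = 0 summands of λ(j+2) and λ(j+1) coincide
  head = lamTermP (suc j) 0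
  tail = sumP n (λ k → lamTermP (suc j) (suc k))

lamP≋Λ : ∀ j → (lamP j ≋ Λ j) × (lamP (suc j) ≋ Λ (suc j))
lamP≋Λ zero = ≋-refl , ≋-refl
lamP≋Λ (suc j) with lamP≋Λ j
... | ih₀ , ih₁ = ih₁ , ≋-trans (lamP-rec j) (+-cong ih₁ (*P-congˡ (negOffDiag² j) ih₀))

lam≽Λ : ∀ j → lam j ≽ poly (Λ j)
lam≽Λ j = ≽-trans (lam≽lamP j) (poly-≽ (proj₁ (lamP≋Λ j)))

1F*F≽ : ∀ F → (1F *F F) ≽ F
1F*F≽ (a / b) = scaledBy 1P ≋-refl ≋-refl

poly-÷F : ∀ a b → (poly a ÷F poly b) ≽ (a / b)
poly-÷F a b = scaledBy 1P (R.*-comm a 1P) ≋-refl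

poly-*Fˡ : ∀ p a b → (poly p *F (a / b)) ≽ ((p *P a) / b)
poly-*Fˡ p a b = scaledBy 1P (≋-sym (R.*-identityˡ (p *P a))) ≋-refl

*F-polyʳ : ∀ a b p → ((a / b) *F poly p) ≽ ((a *P p) / b)
*F-polyʳ a b p = scaledBy 1P (≋-sym (R.*-identityˡ (a *P p))) (R.*-comm b 1P)

+F-sameDen : ∀ x y b → ((x / b) +F (y / b)) ≽ ((x +P y) / b)
+F-sameDen x y b = scaledBy b (≋-trans (R.+-cong (R.*-comm x b) (R.*-comm y b)) (≋-sym (R.distribˡ b x y))) ≋-refl

-- F · (G/H) · (H/G) = F, as a rescaling that needs no hypothesis on G, H
cancel-÷F : ∀ F G H → ((F *F (G ÷F H)) *F (H ÷F G)) ≽ F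
cancel-÷F (n / d) (gn / gd) (hn / hd) = scaledBy ((gn *P hd) *P (hn *P gd)) (numerator n gn hd hn gd) (denominator d gn hd hn gd)
  where
  numerator : ∀ n gn hd hn gd → (n *P (gn *P hd)) *P (hn *P gd) ≋ ((gn *P hd) *P (hn *P gd)) *P n
  numerator = solve-∀ PolySolverRing
  denominator : ∀ d gn hd hn gd → (d *P (gd *P hn)) *P (hd *P gn) ≋ ((gn *P hd) *P (hn *P gd)) *P d
  denominator = solve-∀ PolySolverRing

≋⇒≈F1 : ∀ {x b} → x ≋ b → (x / b) ≈F 1F
≋⇒≈F1 {x} {b} x≋b = un (≋-trans (R.*-identityʳ x) (≋-trans x≋b (≋-sym (R.*-identityˡ b))))

wsPow≽ : ∀ t → (wF *F qhalf^ t) ≽ poly (offDiag t)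
wsPow≽ t = poly-*F ((+ 1 , 1 , 0) ∷ []) ((+ 1 , 0 , t) ∷ [])

lamRatio≽ : ∀ j j' → (lam j ÷F lam j') ≽ (Λ j / Λ j')
lamRatio≽ j j' = ≽-trans (÷F-cong (lam≽Λ j) (lam≽Λ j')) (poly-÷F (Λ j) (Λ j'))

sumBelow : ℕ → (ℕ → Frac) → Frac
sumBelow n g = sumFin n (λ k → g (toℕ k))

sumBelow-vanish : ∀ n g → (∀ m → Vanishes (g m)) → Vanishes (sumBelow n g)
sumBelow-vanish zero g z = ≋-refl
sumBelow-vanish (suc n) g z =
  vanishes-+F {g 0} {sumBelow n (λ m → g (suc m))} (z 0) (sumBelow-vanish n (λ m → g (suc m)) (λ m → z (suc m)))

sumBelow-single : ∀ n g a → a < n → (∀ m → m ≢ a → Vanishes (g m)) → sumBelow n g ≽ g a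
sumBelow-single (suc n) g zero a<n z =
  +F-vanishingʳ {g 0} {sumBelow n (λ m → g (suc m))} (sumBelow-vanish n (λ m → g (suc m)) (λ m → z (suc m) (λ ())))
sumBelow-single (suc n) g (suc a) (s≤s a<n) z =
  ≽-trans (+F-vanishingˡ {g 0} {sumBelow n (λ m → g (suc m))} (z 0 (λ ())))
          (sumBelow-single n (λ m → g (suc m)) a a<n (λ m m≢a → z (suc m) (λ e → m≢a (ℕP.suc-injective e))))

sumBelow-pair : ∀ n g a → suc a < n → (∀ m → m ≢ a → m ≢ suc a → Vanishes (g m)) → sumBelow n g ≽ (g a +F g (suc a))
sumBelow-pair (suc n) g zero (s≤s 1<n) z =
  +F-cong {g 0} ≽-refl (sumBelow-single n (λ m → g (suc m)) 0 1<n (λ m m≢0 → z (suc m) (λ ()) (λ e → m≢0 (ℕP.suc-injective e))))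
sumBelow-pair (suc n) g (suc a) (s≤s a+1<n) z =
  ≽-trans (+F-vanishingˡ {g 0} {sumBelow n (λ m → g (suc m))} (z 0 (λ ()) (λ ())))
          (sumBelow-pair n (λ m → g (suc m)) a a+1<n
            (λ m m≢a m≢a+1 → z (suc m) (λ e → m≢a (ℕP.suc-injective e)) (λ e → m≢a+1 (ℕP.suc-injective e))))

≡ᵇ-refl : ∀ m → (m ≡ᵇ m) ≡ true
≡ᵇ-refl m = dec-true (m ℕP.≟ m) refl

≡ᵇ-false : ∀ {m n} → m ≢ n → (m ≡ᵇ n) ≡ false
≡ᵇ-false {m} {n} = dec-false (m ℕP.≟ n)

n≢1+n : ∀ n → n ≢ suc n
n≢1+n n e = ℕP.1+n≢n (sym e)

2+n≢n : ∀ n → suc (suc n) ≢ n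
2+n≢n zero ()
2+n≢n (suc n) e = 2+n≢n n (ℕP.suc-injective e)

L-diag : ∀ i → Lℕ i i ≡ 1F
L-diag i rewrite ≡ᵇ-refl i = refl

L-sub : ∀ j → Lℕ (suc j) j ≡ (wF *F qhalf^ j) *F (lam j ÷F lam (suc j))
L-sub j rewrite ≡ᵇ-false (ℕP.1+n≢n {j}) | ≡ᵇ-refl j = refl

L-vanish : ∀ i m → i ≢ m → i ≢ suc m → Vanishes (Lℕ i m)
L-vanish i m i≢m i≢1+m rewrite ≡ᵇ-false i≢m | ≡ᵇ-false i≢1+m = ≋-refl

U-diag : ∀ i → Uℕ i i ≡ lam (suc i) ÷F lam i
U-diag i rewrite ≡ᵇ-refl i = refl

U-super : ∀ i → Uℕ i (suc i) ≡ wF *F qhalf^ i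
U-super i rewrite ≡ᵇ-false (n≢1+n i) | ≡ᵇ-refl i = refl

U-vanish : ∀ m j → m ≢ j → suc m ≢ j → Vanishes (Uℕ m j)
U-vanish m j m≢j 1+m≢j rewrite ≡ᵇ-false m≢j | ≡ᵇ-false 1+m≢j = ≋-refl

M-diag : ∀ i → Mℕ i i ≡ 1F
M-diag i rewrite ≡ᵇ-refl i = refl

M-super : ∀ i → Mℕ i (suc i) ≡ wF *F qhalf^ i
M-super i rewrite ≡ᵇ-false (n≢1+n i) | ≡ᵇ-refl i = refl

M-sub : ∀ j → Mℕ (suc j) j ≡ wF *F qhalf^ j
M-sub j rewrite ≡ᵇ-false (ℕP.1+n≢n {j}) | ≡ᵇ-false (2+n≢n j) | ≡ᵇ-refl j = refl

M-zero : ∀ i j → i ≢ j → suc i ≢ j → i ≢ suc j → Mℕ i j ≡ 0F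
M-zero i j i≢j 1+i≢j i≢1+j rewrite ≡ᵇ-false i≢j | ≡ᵇ-false 1+i≢j | ≡ᵇ-false i≢1+j = refl

-- Part (2): the entries of LU.

summand : ℕ → ℕ → ℕ → Frac
summand i j m = Lℕ i m *F Uℕ m j

LU : ℕ → ℕ → ℕ → Frac
LU n i j = sumBelow n (summand i j)

≈F-refl : ∀ F → F ≈F F
≈F-refl F x y = refl

summand-vanish : ∀ i j m → (m ≡ i → Vanishes (Uℕ m j)) → (suc m ≡ i → Vanishes (Uℕ m j)) →
  Vanishes (summand i j m)
summand-vanish i j m onDiag onSub with m ℕP.≟ i | suc m ℕP.≟ i
... | yes m≡i | _ = vanishes-*Fʳ {Lℕ i m} {Uℕ m j} (onDiag m≡i)
... | no _ | yes 1+m≡i = vanishes-*Fʳ {Lℕ i m} {Uℕ m j} (onSub 1+m≡i)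
... | no m≢i | no 1+m≢i = vanishes-*Fˡ {Lℕ i m} {Uℕ m j} (L-vanish i m (λ e → m≢i (sym e)) (λ e → 1+m≢i (sym e)))

-- diagonal: U_{00} = λ(1)/λ(0) = 1, and for t ≥ 0
--   L_{t+1,t} U_{t,t+1} + U_{t+1,t+1} = (w s^t)² Λ t / Λ (t+1) + Λ (t+2) / Λ (t+1) = 1
LU-diag : ∀ n i → i < n → LU n i i ≈F 1F
LU-diag n zero 0<n = ≽-≈F {LU n 0 0} {Λ 1 / Λ 0} {1F} simplified (≈F-refl 1F)
  where
  open ≽-Reasoning
  simplified : LU n 0 0 ≽ (Λ 1 / Λ 0)
  simplified = begin
    LU n 0 0
      ≲⟨ sumBelow-single n (summand 0 0) 0 0<n (λ m m≢0 → summand-vanish 0 0 m (λ m≡0 → ⊥-elim (m≢0 m≡0)) (λ ())) ⟩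
    summand 0 0 0
      ≡⟨ cong₂ _*F_ (L-diag 0) (U-diag 0) ⟩
    1F *F (lam 1 ÷F lam 0)
      ≲⟨ ≽-trans (1F*F≽ (lam 1 ÷F lam 0)) (lamRatio≽ 1 0) ⟩
    Λ 1 / Λ 0
      ∎
LU-diag n (suc t) t+1<n = ≽-≈F {LU n (suc t) (suc t)} {(((o *P a) *P o) +P c) / b} {1F} simplified (≋⇒≈F1 (continuant o a b))
  where
  open ≽-Reasoning
  o = offDiag t
  a = Λ t
  b = Λ (suc t)
  c = Λ (suc (suc t))
  simplified : LU n (suc t) (suc t) ≽ ((((o *P a) *P o) +P c) / b)
  simplified = begin
    LU n (suc t) (suc t)
      ≲⟨ sumBelow-pair n (summand (suc t) (suc t)) t t+1<n (λ m m≢t m≢t+1 → summand-vanish (suc t) (suc t) m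
           (λ m≡t+1 → ⊥-elim (m≢t+1 m≡t+1)) (λ 1+m≡t+1 → ⊥-elim (m≢t (ℕP.suc-injective 1+m≡t+1)))) ⟩
    summand (suc t) (suc t) t +F summand (suc t) (suc t) (suc t)
      ≡⟨ cong₂ _+F_ (cong₂ _*F_ (L-sub t) (U-super t)) (cong₂ _*F_ (L-diag (suc t)) (U-diag (suc t))) ⟩
    (((wF *F qhalf^ t) *F (lam t ÷F lam (suc t))) *F (wF *F qhalf^ t)) +F (1F *F (lam (suc (suc t)) ÷F lam (suc t)))
      ≲⟨ +F-cong (*F-cong (*F-cong (wsPow≽ t) (lamRatio≽ t (suc t))) (wsPow≽ t))
                 (≽-trans (1F*F≽ (lam (suc (suc t)) ÷F lam (suc t))) (lamRatio≽ (suc (suc t)) (suc t))) ⟩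
    ((poly o *F (a / b)) *F poly o) +F (c / b)
      ≲⟨ +F-cong (≽-trans (*F-cong (poly-*Fˡ o a b) (≽-refl {poly o})) (*F-polyʳ (o *P a) b o)) (≽-refl {c / b}) ⟩
    (((o *P a) *P o) / b) +F (c / b)
      ≲⟨ +F-sameDen ((o *P a) *P o) c b ⟩
    (((o *P a) *P o) +P c) / b
      ∎
  -- o² a + (b − o² a) = b, as c = b − o² a is the continuant recurrence
  continuant : ∀ o a b → ((o *P a) *P o) +P (b +P ((-P (o *P o)) *P a)) ≋ b
  continuant = solve-∀ PolySolverRing

LU-super : ∀ n i → i < n → LU n i (suc i) ≈F (wF *F qhalf^ i)
LU-super n i i<n = ≽-≈F {LU n i (suc i)} {wF *F qhalf^ i} {wF *F qhalf^ i} simplified (≈F-refl (wF *F qhalf^ i))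
  where
  open ≽-Reasoning
  simplified : LU n i (suc i) ≽ (wF *F qhalf^ i)
  simplified = begin
    LU n i (suc i)
      ≲⟨ sumBelow-single n (summand i (suc i)) i i<n (λ m m≢i → summand-vanish i (suc i) m (λ m≡i → ⊥-elim (m≢i m≡i))
           (λ { refl → U-vanish m (suc (suc m)) (λ e → 2+n≢n m (sym e)) (n≢1+n (suc m)) })) ⟩
    summand i (suc i) i
      ≡⟨ cong₂ _*F_ (L-diag i) (U-super i) ⟩
    1F *F (wF *F qhalf^ i)
      ≲⟨ 1F*F≽ (wF *F qhalf^ i) ⟩
    wF *F qhalf^ i
      ∎

-- subdiagonal: L_{j+1,j} U_{jj} = w s^j · λ(j)/λ(j+1) · λ(j+1)/λ(j) = w s^j
LU-sub : ∀ n j → j < n → LU n (suc j) j ≈F (wF *F qhalf^ j)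
LU-sub n j j<n = ≽-≈F {LU n (suc j) j} {wF *F qhalf^ j} {wF *F qhalf^ j} simplified (≈F-refl (wF *F qhalf^ j))
  where
  open ≽-Reasoning
  simplified : LU n (suc j) j ≽ (wF *F qhalf^ j)
  simplified = begin
    LU n (suc j) j
      ≲⟨ sumBelow-single n (summand (suc j) j) j j<n (λ m m≢j → summand-vanish (suc j) j m
           (λ { refl → U-vanish (suc j) j ℕP.1+n≢n (2+n≢n j) }) (λ 1+m≡1+j → ⊥-elim (m≢j (ℕP.suc-injective 1+m≡1+j)))) ⟩
    summand (suc j) j j
      ≡⟨ cong₂ _*F_ (L-sub j) (U-diag j) ⟩
    ((wF *F qhalf^ j) *F (lam j ÷F lam (suc j))) *F (lam (suc j) ÷F lam j)
      ≲⟨ cancel-÷F (wF *F qhalf^ j) (lam j) (lam (suc j)) ⟩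
    wF *F qhalf^ j
      ∎

LU-zero : ∀ n i j → i ≢ j → suc i ≢ j → i ≢ suc j → Vanishes (LU n i j)
LU-zero n i j i≢j 1+i≢j i≢1+j = sumBelow-vanish n (summand i j) (λ m → summand-vanish i j m
  (λ { refl → U-vanish m j i≢j 1+i≢j })
  (λ { refl → U-vanish m j (λ m≡j → i≢1+j (cong suc m≡j)) i≢j }))

LU≈M : ∀ n i j → i < n → j < n → LU n i j ≈F Mℕ i j
LU≈M n i j i<n j<n with i ℕP.≟ j | suc i ℕP.≟ j | i ℕP.≟ suc j
... | yes refl | _ | _ = subst (LU n i i ≈F_) (sym (M-diag i)) (LU-diag n i i<n)
... | no _ | yes refl | _ = subst (LU n i (suc i) ≈F_) (sym (M-super i)) (LU-super n i i<n)
... | no _ | no _ | yes refl = subst (LU n (suc j) j ≈F_) (sym (M-sub j)) (LU-sub n j j<n)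
... | no i≢j | no 1+i≢j | no i≢1+j =
  subst (LU n i j ≈F_) (sym (M-zero i j i≢j 1+i≢j i≢1+j)) (vanishes⇒≈0F {LU n i j} (LU-zero n i j i≢j 1+i≢j i≢1+j))

mainTheorem5 : (∀ j → ¬ (lam j ≈F 0F))
    × (∀ n → (L (suc n) ⊗ U (suc n)) ≈M M (suc n))
mainTheorem5 = lam≉0 , λ n i j → LU≈M (suc n) (toℕ i) (toℕ j) (FinP.toℕ<n i) (FinP.toℕ<n j)
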